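{- Let $q>2$ and let $\Pi$ be a projective plane of order $q$ with point set identified with $[q^2+q+1]$. Then the set $\mathcal{L}$ of lines of $\Pi$ (each line viewed as a $(q+1)$-subset of points) is not a resolving set for the Kneser graph $K(q^2+q+1,q+1)$.
   Context: A projective plane of order $q$ is a set of $q^2+q+1$ points together with a family of $(q+1)$-subsets called lines such that any two distinct points lie on exactly one common line (equivalently a symmetric 2-design with parameters $(q^2+q+1,q+1,1)$); in it, every point lies on $q+1$ lines and any two lines meet in exactly one point. The Kneser graph $K(n,k)$ has as vertices the $k$-subsets of $[n]$, adjacent when disjoint. A resolving set is a set $\mathcal{S}$ of vertices such that for all distinct vertices $U,W$ some $X\in\mathcal{S}$ has $d(U,X)\neq d(W,X)$. -}

module Defs where

open import Data.Nat using (ℕ; zero; suc; _+_; _*_; _≤_)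
open import Data.Fin using (Fin)
open import Data.Fin.Subset using (Subset; _∈_; _∩_; ∣_∣) renaming (⊥ to ∅)
open import Data.Product using (Σ; ∃; _×_; proj₁)
open import Relation.Binary.PropositionalEquality using (_≡_; _≢_)

data Walk {A : Set} (Adj : A → A → Set) : A → A → ℕ → Set where
  here : ∀ {x} → Walk Adj x x zero
  step : ∀ {x y z n} → Adj x y → Walk Adj y z n → Walk Adj x z (suc n)

Dist : {A : Set} → (A → A → Set) → A → A → ℕ → Set
Dist Adj x y d = Walk Adj x y d × (∀ m → Walk Adj x y m → d ≤ m)

IsResolving : {A : Set} → (A → A → Set) → (A → A → Set) → (A → Set) → Set
IsResolving {A} Adj Distinct S =
  ∀ (U W : A) → Distinct U W →
    ∃ λ X → S X × ∃ λ d₁ → ∃ λ d₂ → Dist Adj U X d₁ × Dist Adj W X d₂ × d₁ ≢ d₂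

KVertex : ℕ → ℕ → Set
KVertex n k = Σ (Subset n) (λ s → ∣ s ∣ ≡ k)

KAdj : ∀ {n k} → KVertex n k → KVertex n k → Set
KAdj U W = proj₁ U ∩ proj₁ W ≡ ∅

KDistinct : ∀ {n k} → KVertex n k → KVertex n k → Set
KDistinct U W = proj₁ U ≢ proj₁ W

nPts : ℕ → ℕ
nPts q = q * q + q + 1

record IsProjectivePlane (q : ℕ) (Line : Subset (nPts q) → Set) : Set where
  field
    line-size : ∀ ℓ → Line ℓ → ∣ ℓ ∣ ≡ suc q
    joining   : ∀ (x y : Fin (nPts q)) → x ≢ y →
                  ∃ λ ℓ → Line ℓ × x ∈ ℓ × y ∈ ℓ
    unique    : ∀ (x y : Fin (nPts q)) → x ≢ y → ∀ ℓ ℓ' →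
                  Line ℓ → x ∈ ℓ → y ∈ ℓ →
                  Line ℓ' → x ∈ ℓ' → y ∈ ℓ' → ℓ ≡ ℓ'

LinesAsVertices : ∀ {q} → (Subset (nPts q) → Set) → KVertex (nPts q) (suc q) → Set
LinesAsVertices Line X = Line (proj₁ X)

module Submission where

-- Fix a line ℓ, a point p on it, and let C = ℓ ∖ {p} (q points).  Take a
-- point x off ℓ, the line m through p and x, and a third point y of m.  The
-- (q+1)-sets U = C ∪ {x} and W = C ∪ {y} are not lines, and a line avoids U
-- exactly when it avoids W: a line missing C passes through p (two lines
-- always meet), and a line through p containing x or y is m, which meets
-- both.  As K(n,k) has diameter 2 for n ≥ 3k, the distance from U or W to
-- a line is 1 or 2 according to disjointness, so no line separates U, W.

open import Defs
open import Data.Nat using (ℕ; zero; suc; _+_; _*_; _∸_; _≤_; _<_; z≤n; s≤s; s≤s⁻¹)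
open import Data.Nat.Properties
open import Data.Nat.Tactic.RingSolver using (solve-∀)
open import Data.Bool using (true; false)
import Data.Bool as Bool
open import Data.Fin using (Fin; zero; suc)
import Data.Fin.Properties as Fin
open import Data.Fin.Subset
  using (Subset; _∈_; _∉_; _⊆_; _∩_; _∪_; _-_; ∁; ⁅_⁆; ∣_∣; ⊤)
  renaming (⊥ to ∅)
open import Data.Fin.Subset.Properties
open import Data.Vec.Base using ([]; _∷_; here; there)
open import Data.Vec.Properties using (≡-dec)
open import Data.Product using (∃; _×_; _,_; proj₁; proj₂)
import Data.Product as Product
open import Data.Sum using (inj₁; inj₂)
open import Data.Empty using (⊥; ⊥-elim)
open import Function.Base using (_∘_)
open import Function.Bundles using (_⇔_; mk⇔; Equivalence)
open import Function.Definitions using (Injective)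
open import Relation.Nullary using (¬_; Dec; yes; no)
open import Relation.Nullary.Decidable using (map′)
open import Relation.Binary.PropositionalEquality

Disjoint : ∀ {n} → Subset n → Subset n → Set
Disjoint p q = ∀ {z} → z ∈ p → z ∈ q → ⊥

∩≡∅⇒disjoint : ∀ {n} {p q : Subset n} → p ∩ q ≡ ∅ → Disjoint p q
∩≡∅⇒disjoint p∩q≡∅ zp zq =
  ∉⊥ (subst (_ ∈_) p∩q≡∅ (x∈p∩q⁺ (zp , zq)))

disjoint⇒∩≡∅ : ∀ {n} (p q : Subset n) → Disjoint p q → p ∩ q ≡ ∅
disjoint⇒∩≡∅ []          []          d = refl
disjoint⇒∩≡∅ (true ∷ p)  (true ∷ q)  d = ⊥-elim (d here here)
disjoint⇒∩≡∅ (true ∷ p)  (false ∷ q) d =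
  cong (false ∷_) (disjoint⇒∩≡∅ p q (λ zp zq → d (there zp) (there zq)))
disjoint⇒∩≡∅ (false ∷ p) (b ∷ q)     d =
  cong (false ∷_) (disjoint⇒∩≡∅ p q (λ zp zq → d (there zp) (there zq)))

disjoint? : ∀ {n} (p q : Subset n) → Dec (Disjoint p q)
disjoint? p q =
  map′ ∩≡∅⇒disjoint (disjoint⇒∩≡∅ p q) (≡-dec Bool._≟_ (p ∩ q) ∅)

∣∪∣-disjoint : ∀ {n} (p q : Subset n) → Disjoint p q →
               ∣ p ∪ q ∣ ≡ ∣ p ∣ + ∣ q ∣
∣∪∣-disjoint []          []          d = refl
∣∪∣-disjoint (true ∷ p)  (true ∷ q)  d = ⊥-elim (d here here)
∣∪∣-disjoint (true ∷ p)  (false ∷ q) d =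
  cong suc (∣∪∣-disjoint p q (λ zp zq → d (there zp) (there zq)))
∣∪∣-disjoint (false ∷ p) (true ∷ q)  d =
  trans (cong suc (∣∪∣-disjoint p q (λ zp zq → d (there zp) (there zq))))
        (sym (+-suc ∣ p ∣ ∣ q ∣))
∣∪∣-disjoint (false ∷ p) (false ∷ q) d =
  ∣∪∣-disjoint p q (λ zp zq → d (there zp) (there zq))

∣∪∣≤ : ∀ {n} (p q : Subset n) → ∣ p ∪ q ∣ ≤ ∣ p ∣ + ∣ q ∣
∣∪∣≤ []          []          = z≤n
∣∪∣≤ (true ∷ p)  (b ∷ q)     = s≤s (≤-trans (∣∪∣≤ p q) (+-monoʳ-≤ ∣ p ∣ (∣p∣≤∣x∷p∣ b q)))
∣∪∣≤ (false ∷ p) (true ∷ q)  = ≤-trans (s≤s (∣∪∣≤ p q)) (≤-reflexive (sym (+-suc ∣ p ∣ ∣ q ∣)))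
∣∪∣≤ (false ∷ p) (false ∷ q) = ∣∪∣≤ p q

x∉p-x : ∀ {n} (p : Subset n) (x : Fin n) → x ∉ p - x
x∉p-x (b ∷ p) (suc x) (there h) = x∉p-x p x h

∈-x⇒∈ : ∀ {n} {p : Subset n} {x z : Fin n} → z ∈ p - x → z ∈ p
∈-x⇒∈ {p = p} {x} = p─q⊆p p ⁅ x ⁆

∈-x⇒≢ : ∀ {n} {p : Subset n} {x z : Fin n} → z ∈ p - x → z ≢ x
∈-x⇒≢ {p = p} z∈p-x refl = x∉p-x p _ z∈p-x

∣p∣≤1+∣p-x∣ : ∀ {n} (p : Subset n) (x : Fin n) → ∣ p ∣ ≤ suc ∣ p - x ∣
∣p∣≤1+∣p-x∣ (true ∷ p)  zero    = s≤s (≤-reflexive (cong ∣_∣ (sym (p─⊥≡p p))))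
∣p∣≤1+∣p-x∣ (false ∷ p) zero    = m≤n⇒m≤1+n (≤-reflexive (cong ∣_∣ (sym (p─⊥≡p p))))
∣p∣≤1+∣p-x∣ (true ∷ p)  (suc x) = s≤s (∣p∣≤1+∣p-x∣ p x)
∣p∣≤1+∣p-x∣ (false ∷ p) (suc x) = ∣p∣≤1+∣p-x∣ p x

∣p-x∣ : ∀ {n} {p : Subset n} {x : Fin n} → x ∈ p → suc ∣ p - x ∣ ≡ ∣ p ∣
∣p-x∣ {p = p} {x} x∈p = ≤-antisym (x∈p⇒∣p-x∣<∣p∣ x∈p) (∣p∣≤1+∣p-x∣ p x)

choose : ∀ {n} (p : Subset n) → 0 < ∣ p ∣ → ∃ λ z → z ∈ p
choose (true ∷ p)  _ = zero , here
choose (false ∷ p) h = Product.map suc there (choose p h)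

choose-besides : ∀ {n} (p : Subset n) → 1 < ∣ p ∣ → (x : Fin n) → ∃ λ z → z ∈ p - x
choose-besides p h x = choose (p - x) (s≤s⁻¹ (≤-trans h (∣p∣≤1+∣p-x∣ p x)))

subset-of-size : ∀ {n} k (p : Subset n) → k ≤ ∣ p ∣ → ∃ λ Y → Y ⊆ p × ∣ Y ∣ ≡ k
subset-of-size {n} zero p _ = ∅ , ⊥⊆ , ∣⊥∣≡0 n
subset-of-size (suc k) (true ∷ p) (s≤s h) =
  let (Y , Y⊆p , ∣Y∣) = subset-of-size k p h in true ∷ Y , in⊆in Y⊆p , cong suc ∣Y∣
subset-of-size (suc k) (false ∷ p) h =
  let (Y , Y⊆p , ∣Y∣) = subset-of-size (suc k) p h in false ∷ Y , out⊆ Y⊆p , ∣Y∣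

enumerate : ∀ {n} (p : Subset n) →
            ∃ λ (e : Fin ∣ p ∣ → Fin n) → Injective _≡_ _≡_ e × (∀ i → e i ∈ p)
enumerate [] = (λ ()) , (λ {i} → ⊥-elim (Fin.¬Fin0 i)) , (λ ())
enumerate (false ∷ p) =
  let (e , e-inj , e∈p) = enumerate p
  in suc ∘ e , e-inj ∘ Fin.suc-injective , there ∘ e∈p
enumerate {suc n} (true ∷ p) = e′ , e′-inj , e′∈p
  where
  e : Fin ∣ p ∣ → Fin n
  e = proj₁ (enumerate p)
  e′ : Fin (suc ∣ p ∣) → Fin (suc n)
  e′ zero    = zero
  e′ (suc i) = suc (e i)
  e′-inj : Injective _≡_ _≡_ e′
  e′-inj {zero}  {zero}  _  = refl
  e′-inj {suc i} {suc j} eq = cong suc (proj₁ (proj₂ (enumerate p)) (Fin.suc-injective eq))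
  e′∈p : ∀ i → e′ i ∈ true ∷ p
  e′∈p zero    = here
  e′∈p (suc i) = there (proj₂ (proj₂ (enumerate p)) i)

⋃ᶠ : ∀ {n k} → (Fin k → Subset n) → Subset n
⋃ᶠ {k = zero}  F = ∅
⋃ᶠ {k = suc k} F = F zero ∪ ⋃ᶠ (F ∘ suc)

∈⋃ᶠ⁻ : ∀ {n} k (F : Fin k → Subset n) {z} → z ∈ ⋃ᶠ F → ∃ λ i → z ∈ F i
∈⋃ᶠ⁻ zero    F z∈⋃ = ⊥-elim (∉⊥ z∈⋃)
∈⋃ᶠ⁻ (suc k) F z∈⋃ with x∈p∪q⁻ (F zero) (⋃ᶠ (F ∘ suc)) z∈⋃
... | inj₁ z∈F₀ = zero , z∈F₀
... | inj₂ z∈⋃′ = Product.map suc (λ z∈Fᵢ → z∈Fᵢ) (∈⋃ᶠ⁻ k (F ∘ suc) z∈⋃′)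

∣⋃ᶠ∣-disjoint : ∀ {n} k c (F : Fin k → Subset n) → (∀ i → c ≤ ∣ F i ∣) →
                (∀ {i j} → i ≢ j → Disjoint (F i) (F j)) → k * c ≤ ∣ ⋃ᶠ F ∣
∣⋃ᶠ∣-disjoint zero    c F big disj = z≤n
∣⋃ᶠ∣-disjoint (suc k) c F big disj = begin
  c + k * c                   ≤⟨ +-mono-≤ (big zero) (∣⋃ᶠ∣-disjoint k c (F ∘ suc) (big ∘ suc)
                                   (λ i≢j → disj (i≢j ∘ Fin.suc-injective))) ⟩
  ∣ F zero ∣ + ∣ ⋃ᶠ (F ∘ suc) ∣ ≡⟨ sym (∣∪∣-disjoint (F zero) (⋃ᶠ (F ∘ suc)) F₀-disjoint) ⟩
  ∣ ⋃ᶠ F ∣                    ∎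
  where
  open ≤-Reasoning
  F₀-disjoint : Disjoint (F zero) (⋃ᶠ (F ∘ suc))
  F₀-disjoint z∈F₀ z∈⋃ =
    let (i , z∈Fᵢ) = ∈⋃ᶠ⁻ k (F ∘ suc) z∈⋃ in disj (λ ()) z∈F₀ z∈Fᵢ

disjoint-family-bound : ∀ {n} k c (F : Fin k → Subset n) → (∀ i → c ≤ ∣ F i ∣) →
                        (∀ {i j} → i ≢ j → Disjoint (F i) (F j)) →
                        (z : Fin n) → (∀ i → z ∉ F i) → k * c < n
disjoint-family-bound {n} k c F big disj z z∉F = begin-strict
  k * c       ≤⟨ ∣⋃ᶠ∣-disjoint k c F big disj ⟩
  ∣ ⋃ᶠ F ∣    <⟨ p⊂q⇒∣p∣<∣q∣ (⊆⊤ , z , ∈⊤ , z∉⋃) ⟩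
  ∣ ⊤ {n} ∣   ≡⟨ ∣⊤∣≡n n ⟩
  n           ∎
  where
  open ≤-Reasoning
  z∉⋃ : z ∉ ⋃ᶠ F
  z∉⋃ z∈⋃ = let (i , z∈Fᵢ) = ∈⋃ᶠ⁻ k F z∈⋃ in z∉F i z∈Fᵢ

module _ {A : Set} {Adj : A → A → Set} where

  dist-adjacent : ∀ {x y d} → x ≢ y → Adj x y → Dist Adj x y d → d ≡ 1
  dist-adjacent x≢y _   (here , _)                = ⊥-elim (x≢y refl)
  dist-adjacent _   _   (step _ here , _)         = refl
  dist-adjacent _   xy  (step _ (step _ _) , min) with min 1 (step xy here)
  ... | s≤s ()

  dist-common-neighbour : ∀ {x y z d} → x ≢ y → ¬ Adj x y → Adj x z → Adj z y →
                          Dist Adj x y d → d ≡ 2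
  dist-common-neighbour x≢y _    _  _  (here , _)                = ⊥-elim (x≢y refl)
  dist-common-neighbour _   ¬xy  _  _  (step xy here , _)        = ⊥-elim (¬xy xy)
  dist-common-neighbour _   _    xz zy (step _ (step _ _) , min) with min 2 (step xz (step zy here))
  ... | s≤s (s≤s z≤n) = refl

KDisjoint : ∀ {n k} → KVertex n k → KVertex n k → Set
KDisjoint U X = Disjoint (proj₁ U) (proj₁ X)

-- When n ≥ 3k any two vertices have a common neighbour: a k-subset of the
-- complement of their union, which has at least n - 2k ≥ k points.
common-neighbour : ∀ {n k} → 3 * k ≤ n → (U X : KVertex n k) →
                   ∃ λ Y → KAdj U Y × KAdj Y X
common-neighbour {n} {k} 3k≤n (U , ∣U∣) (X , ∣X∣) =
  let (Y , Y⊆∁ , ∣Y∣) = subset-of-size k (∁ (U ∪ X)) k≤∣∁U∪X∣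
      avoids : Disjoint (U ∪ X) Y
      avoids z∈U∪X z∈Y = x∈∁p⇒x∉p (Y⊆∁ z∈Y) z∈U∪X
  in (Y , ∣Y∣)
     , disjoint⇒∩≡∅ U Y (λ z∈U → avoids (x∈p∪q⁺ (inj₁ z∈U)))
     , disjoint⇒∩≡∅ Y X (λ z∈Y z∈X → avoids (x∈p∪q⁺ (inj₂ z∈X)) z∈Y)
  where
  open ≤-Reasoning
  k+2k≤n : k + (k + k) ≤ n
  k+2k≤n = subst (_≤ n) (cong (λ t → k + (k + t)) (+-identityʳ k)) 3k≤n
  k≤∣∁U∪X∣ : k ≤ ∣ ∁ (U ∪ X) ∣
  k≤∣∁U∪X∣ = begin
    k                   ≤⟨ m+n≤o⇒m≤o∸n k k+2k≤n ⟩
    n ∸ (k + k)         ≡⟨ cong₂ (λ a b → n ∸ (a + b)) (sym ∣U∣) (sym ∣X∣) ⟩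
    n ∸ (∣ U ∣ + ∣ X ∣) ≤⟨ ∸-monoʳ-≤ n (∣∪∣≤ U X) ⟩
    n ∸ ∣ U ∪ X ∣       ≡⟨ sym (∣∁p∣≡n∸∣p∣ (U ∪ X)) ⟩
    ∣ ∁ (U ∪ X) ∣       ∎

kneser-distance : ∀ {n k} → 3 * k ≤ n → (U X : KVertex n k) → KDistinct U X →
                  ∀ {d} → Dist KAdj U X d →
                  (KDisjoint U X → d ≡ 1) × (¬ KDisjoint U X → d ≡ 2)
kneser-distance 3k≤n U X U≢X dist =
    (λ disj → dist-adjacent {Adj = KAdj} U≢X′ (disjoint⇒∩≡∅ (proj₁ U) (proj₁ X) disj) dist)
  , (λ ¬disj → let (Y , UY , YX) = common-neighbour 3k≤n U X in
       dist-common-neighbour {Adj = KAdj} {z = Y} U≢X′ (λ U∩X≡∅ → ¬disj (∩≡∅⇒disjoint U∩X≡∅)) UY YX dist)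
  where
  U≢X′ : U ≢ X
  U≢X′ = U≢X ∘ cong proj₁

twins-not-resolving : ∀ {n k} → 3 * k ≤ n → (S : KVertex n k → Set) →
                      (U W : KVertex n k) → KDistinct U W →
                      (∀ X → S X → KDistinct U X × KDistinct W X × (KDisjoint U X ⇔ KDisjoint W X)) →
                      ¬ IsResolving KAdj KDistinct S
twins-not-resolving 3k≤n S U W U≢W twins resolving
  with resolving U W U≢W
... | X , X∈S , d₁ , d₂ , dist₁ , dist₂ , d₁≢d₂
  with twins X X∈S
... | U≢X , W≢X , same
  with kneser-distance 3k≤n U X U≢X dist₁ | kneser-distance 3k≤n W X W≢X dist₂ | disjoint? (proj₁ U) (proj₁ X)
... | one₁ , _ | one₂ , _ | yes disj = d₁≢d₂ (trans (one₁ disj) (sym (one₂ (Equivalence.to same disj))))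
... | _ , two₁ | _ , two₂ | no ¬disj = d₁≢d₂ (trans (two₁ ¬disj) (sym (two₂ (¬disj ∘ Equivalence.from same))))

-- For q ≥ 3 there is room for three pairwise disjoint (q+1)-sets.
room-for-three-lines : ∀ q → 2 < q → 3 * suc q ≤ nPts q
room-for-three-lines (suc (suc (suc r))) (s≤s (s≤s (s≤s _))) =
  subst (3 * (4 + r) ≤_) (sym (nPts-expand r)) (m≤m+n (3 * (4 + r)) (r * r + 4 * r + 1))
  where
  nPts-expand : ∀ r → (3 + r) * (3 + r) + (3 + r) + 1 ≡ 3 * (4 + r) + (r * r + 4 * r + 1)
  nPts-expand = solve-∀

-- For q ≥ 1, no point can lie on q+2 lines (see pencil-bound below).
pencil-overflow : ∀ q → 0 < q → ¬ (suc (suc q) * q < nPts q)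
pencil-overflow (suc r) _ overflow =
  <⇒≱ overflow (subst (nPts (suc r) ≤_) (sym (expand r)) (m≤m+n (nPts (suc r)) r))
  where
  expand : ∀ r → suc (suc (suc r)) * suc r ≡ (suc r * suc r + suc r + 1) + r
  expand = solve-∀

module Plane {q : ℕ} {Line : Subset (nPts q) → Set} (plane : IsProjectivePlane q Line) where
  open IsProjectivePlane plane

  Point : Set
  Point = Fin (nPts q)

  join : (x y : Point) → x ≢ y → Subset (nPts q)
  join x y x≢y = proj₁ (joining x y x≢y)

  join-line : ∀ x y x≢y → Line (join x y x≢y)
  join-line x y x≢y = proj₁ (proj₂ (joining x y x≢y))

  join-∋ˡ : ∀ x y x≢y → x ∈ join x y x≢y
  join-∋ˡ x y x≢y = proj₁ (proj₂ (proj₂ (joining x y x≢y)))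

  join-∋ʳ : ∀ x y x≢y → y ∈ join x y x≢y
  join-∋ʳ x y x≢y = proj₂ (proj₂ (proj₂ (joining x y x≢y)))

  ∣line-x∣ : ∀ {L x} → Line L → x ∈ L → ∣ L - x ∣ ≡ q
  ∣line-x∣ {L} L-line x∈L = suc-injective (trans (∣p-x∣ x∈L) (line-size L L-line))

  -- Pencil bound: k pairwise distinct lines through a point x give k·q < n,
  -- since outside x they are pairwise disjoint sets of q points.
  pencil-bound : ∀ {k} (x : Point) (F : Fin k → Subset (nPts q)) →
                 (∀ i → Line (F i)) → (∀ i → x ∈ F i) → Injective _≡_ _≡_ F →
                 k * q < nPts q
  pencil-bound {k} x F F-line x∈F F-inj =
    disjoint-family-bound k q (λ i → F i - x)
      (λ i → ≤-reflexive (sym (∣line-x∣ (F-line i) (x∈F i))))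
      (λ {i} {j} i≢j z∈Fᵢ z∈Fⱼ → i≢j (F-inj
        (unique x _ (∈-x⇒≢ z∈Fᵢ ∘ sym) (F i) (F j)
           (F-line i) (x∈F i) (∈-x⇒∈ z∈Fᵢ) (F-line j) (x∈F j) (∈-x⇒∈ z∈Fⱼ))))
      x (λ i → x∉p-x (F i) x)

  -- Joining a point x off a line M to distinct points of M gives distinct
  -- lines: a common joining line would contain two points of M, so be M.
  join-injective : ∀ {M x u v} (x≢u : x ≢ u) (x≢v : x ≢ v) → Line M → x ∉ M →
                   u ∈ M → v ∈ M → join x u x≢u ≡ join x v x≢v → u ≡ v
  join-injective {M} {x} {u} {v} x≢u x≢v M-line x∉M u∈M v∈M same with u Fin.≟ v
  ... | yes u≡v = u≡v
  ... | no  u≢v = ⊥-elim (x∉M (subst (x ∈_) (sym M≡xu) (join-∋ˡ x u x≢u)))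
    where
    M≡xu : M ≡ join x u x≢u
    M≡xu = unique u v u≢v M (join x u x≢u) M-line u∈M v∈M
             (join-line x u x≢u) (join-∋ʳ x u x≢u) (subst (v ∈_) (sym same) (join-∋ʳ x v x≢v))

  -- Any two lines meet.  Otherwise a point x of L lies on L and on the q+1
  -- lines joining x to the points of M, which are q+2 distinct lines.
  lines-meet : 0 < q → ∀ {L M} → Line L → Line M → ¬ Disjoint L M
  lines-meet 0<q {L} {M} L-line M-line L∩M=∅ =
    pencil-overflow q 0<q
      (subst (λ s → suc s * q < nPts q) (line-size M M-line)
        (pencil-bound x pencil pencil-line pencil-∋x pencil-inj))
    where
    x∈L-exists : ∃ λ x → x ∈ L
    x∈L-exists = choose L (subst (0 <_) (sym (line-size L L-line)) (s≤s z≤n))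
    x : Point
    x = proj₁ x∈L-exists
    x∈L : x ∈ L
    x∈L = proj₂ x∈L-exists
    x∉M : x ∉ M
    x∉M = L∩M=∅ x∈L
    e : Fin ∣ M ∣ → Point
    e = proj₁ (enumerate M)
    e-inj : Injective _≡_ _≡_ e
    e-inj = proj₁ (proj₂ (enumerate M))
    e∈M : ∀ i → e i ∈ M
    e∈M = proj₂ (proj₂ (enumerate M))
    x≢e : ∀ i → x ≢ e i
    x≢e i x≡eᵢ = x∉M (subst (_∈ M) (sym x≡eᵢ) (e∈M i))
    pencil : Fin (suc ∣ M ∣) → Subset (nPts q)
    pencil zero    = L
    pencil (suc i) = join x (e i) (x≢e i)
    pencil-line : ∀ i → Line (pencil i)
    pencil-line zero    = L-line
    pencil-line (suc i) = join-line x (e i) (x≢e i)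
    pencil-∋x : ∀ i → x ∈ pencil i
    pencil-∋x zero    = x∈L
    pencil-∋x (suc i) = join-∋ˡ x (e i) (x≢e i)
    joining-line-meets-M : ∀ i → ¬ Disjoint (pencil (suc i)) M
    joining-line-meets-M i disj = disj (join-∋ʳ x (e i) (x≢e i)) (e∈M i)
    pencil-inj : Injective _≡_ _≡_ pencil
    pencil-inj {zero}  {zero}  _    = refl
    pencil-inj {zero}  {suc j} L≡   = ⊥-elim (joining-line-meets-M j (subst (λ N → Disjoint N M) L≡ L∩M=∅))
    pencil-inj {suc i} {zero}  ≡L   = ⊥-elim (joining-line-meets-M i (subst (λ N → Disjoint N M) (sym ≡L) L∩M=∅))
    pencil-inj {suc i} {suc j} same =
      cong suc (e-inj (join-injective (x≢e i) (x≢e j) M-line x∉M (e∈M i) (e∈M j) same))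

  point-off : ∀ {ℓ} → Line ℓ → suc q < nPts q → ∃ λ x → x ∉ ℓ
  point-off {ℓ} ℓ-line q+1<n =
    Product.map₂ x∈∁p⇒x∉p (choose (∁ ℓ) (subst (0 <_) (sym (∣∁p∣≡n∸∣p∣ ℓ))
      (m<n⇒0<n∸m (subst (_< nPts q) (sym (line-size ℓ ℓ-line)) q+1<n))))

module Twins {q : ℕ} {Line : Subset (nPts q) → Set} (plane : IsProjectivePlane q Line)
             (2<q : 2 < q) (p p₁ : Fin (nPts q)) (p≢p₁ : p ≢ p₁) where
  open IsProjectivePlane plane
  open Plane plane

  1<q : 1 < q
  1<q = <-trans (s≤s (s≤s z≤n)) 2<q

  ℓ : Subset (nPts q)
  ℓ = join p p₁ p≢p₁

  ℓ-line : Line ℓ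
  ℓ-line = join-line p p₁ p≢p₁

  p∈ℓ : p ∈ ℓ
  p∈ℓ = join-∋ˡ p p₁ p≢p₁

  C : Subset (nPts q)
  C = ℓ - p

  ∣C∣ : ∣ C ∣ ≡ q
  ∣C∣ = ∣line-x∣ ℓ-line p∈ℓ

  -- Two distinct points p₁, p₂ of C; they show that C determines ℓ.
  p₁∈C : p₁ ∈ C
  p₁∈C = x∈p∧x≢y⇒x∈p-y (join-∋ʳ p p₁ p≢p₁) (p≢p₁ ∘ sym)

  p₂∈C-p₁-exists : ∃ λ p₂ → p₂ ∈ C - p₁
  p₂∈C-p₁-exists = choose-besides C (subst (1 <_) (sym ∣C∣) 1<q) p₁

  p₂ : Point
  p₂ = proj₁ p₂∈C-p₁-exists

  p₂∈C-p₁ : p₂ ∈ C - p₁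
  p₂∈C-p₁ = proj₂ p₂∈C-p₁-exists

  x∉ℓ-exists : ∃ λ x → x ∉ ℓ
  x∉ℓ-exists = point-off ℓ-line (<-≤-trans (m<m+n (suc q) (s≤s z≤n)) (room-for-three-lines q 2<q))

  x : Point
  x = proj₁ x∉ℓ-exists

  x∉ℓ : x ∉ ℓ
  x∉ℓ = proj₂ x∉ℓ-exists

  p≢x : p ≢ x
  p≢x p≡x = x∉ℓ (subst (_∈ ℓ) p≡x p∈ℓ)

  m : Subset (nPts q)
  m = join p x p≢x

  m-line : Line m
  m-line = join-line p x p≢x

  p∈m : p ∈ m
  p∈m = join-∋ˡ p x p≢x

  x∈m-p : x ∈ m - p
  x∈m-p = x∈p∧x≢y⇒x∈p-y (join-∋ʳ p x p≢x) (p≢x ∘ sym)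

  y∈m-p-x : ∃ λ y → y ∈ m - p - x
  y∈m-p-x = choose-besides (m - p) (subst (1 <_) (sym (∣line-x∣ m-line p∈m)) 1<q) x

  y : Point
  y = proj₁ y∈m-p-x

  y∈m-p : y ∈ m - p
  y∈m-p = ∈-x⇒∈ (proj₂ y∈m-p-x)

  -- The points of m other than p are off ℓ, as m ≠ ℓ.
  off-ℓ : ∀ {t} → t ∈ m - p → t ∉ ℓ
  off-ℓ {t} t∈m-p t∈ℓ = x∉ℓ (subst (x ∈_) (sym ℓ≡m) (join-∋ʳ p x p≢x))
    where
    ℓ≡m : ℓ ≡ m
    ℓ≡m = unique p t (∈-x⇒≢ t∈m-p ∘ sym) ℓ m ℓ-line p∈ℓ t∈ℓ m-line p∈m (∈-x⇒∈ t∈m-p)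

  twin : Point → Subset (nPts q)
  twin t = C ∪ ⁅ t ⁆

  C⊆twin : ∀ t {z} → z ∈ C → z ∈ twin t
  C⊆twin t z∈C = x∈p∪q⁺ (inj₁ z∈C)

  t∈twin : ∀ t → t ∈ twin t
  t∈twin t = x∈p∪q⁺ (inj₂ (x∈⁅x⁆ t))

  ∣twin∣ : ∀ {t} → t ∉ ℓ → ∣ twin t ∣ ≡ suc q
  ∣twin∣ {t} t∉ℓ = begin
    ∣ C ∪ ⁅ t ⁆ ∣     ≡⟨ ∣∪∣-disjoint C ⁅ t ⁆ C∩t=∅ ⟩
    ∣ C ∣ + ∣ ⁅ t ⁆ ∣ ≡⟨ cong₂ _+_ ∣C∣ (∣⁅x⁆∣≡1 t) ⟩
    q + 1             ≡⟨ +-comm q 1 ⟩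
    suc q             ∎
    where
    open ≡-Reasoning
    C∩t=∅ : Disjoint C ⁅ t ⁆
    C∩t=∅ z∈C z∈t = t∉ℓ (subst (_∈ ℓ) (x∈⁅y⁆⇒x≡y t z∈t) (∈-x⇒∈ z∈C))

  -- A twin is not a line: it shares the two points p₁, p₂ with ℓ but is not ℓ.
  twin-not-line : ∀ {t} → t ∉ ℓ → ¬ Line (twin t)
  twin-not-line {t} t∉ℓ twin-line = t∉ℓ (subst (t ∈_) (sym ℓ≡twin) (t∈twin t))
    where
    p₂∈C : p₂ ∈ C
    p₂∈C = ∈-x⇒∈ p₂∈C-p₁
    ℓ≡twin : ℓ ≡ twin t
    ℓ≡twin = unique p₁ p₂ (∈-x⇒≢ p₂∈C-p₁ ∘ sym) ℓ (twin t)
               ℓ-line (∈-x⇒∈ p₁∈C) (∈-x⇒∈ p₂∈C) twin-line (C⊆twin t p₁∈C) (C⊆twin t p₂∈C)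

  -- A line avoiding C passes through p, because it meets ℓ.
  avoids-C⇒∋p : ∀ {X} → Line X → Disjoint C X → p ∈ X
  avoids-C⇒∋p {X} X-line C∩X=∅ with p ∈? X
  ... | yes p∈X = p∈X
  ... | no  p∉X = ⊥-elim (lines-meet (<-trans (s≤s z≤n) 1<q) ℓ-line X-line ℓ∩X=∅)
    where
    ℓ∩X=∅ : Disjoint ℓ X
    ℓ∩X=∅ z∈ℓ z∈X = C∩X=∅ (x∈p∧x≢y⇒x∈p-y z∈ℓ (λ z≡p → p∉X (subst (_∈ X) z≡p z∈X))) z∈X

  -- The twin property: for t, t′ ∈ m ∖ {p}, a line avoiding twin t avoids
  -- twin t′.  It passes through p, so containing t′ would make it m ∋ t.
  twin-transfer : ∀ {t t′ X} → t ∈ m - p → t′ ∈ m - p → Line X →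
                  Disjoint (twin t) X → Disjoint (twin t′) X
  twin-transfer {t} {t′} {X} t∈m-p t′∈m-p X-line twin∩X=∅ {z} z∈twin z∈X
    with x∈p∪q⁻ C ⁅ t′ ⁆ z∈twin
  ... | inj₁ z∈C  = twin∩X=∅ (C⊆twin t z∈C) z∈X
  ... | inj₂ z∈t′ = twin∩X=∅ (t∈twin t) (subst (t ∈_) m≡X (∈-x⇒∈ t∈m-p))
    where
    p∈X : p ∈ X
    p∈X = avoids-C⇒∋p X-line (λ z∈C → twin∩X=∅ (C⊆twin t z∈C))
    t′∈X : t′ ∈ X
    t′∈X = subst (_∈ X) (x∈⁅y⁆⇒x≡y t′ z∈t′) z∈X
    m≡X : m ≡ X
    m≡X = unique p t′ (∈-x⇒≢ t′∈m-p ∘ sym) m X m-line p∈m (∈-x⇒∈ t′∈m-p) X-line p∈X t′∈X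

  twin-vertex : ∀ {t} → t ∈ m - p → KVertex (nPts q) (suc q)
  twin-vertex {t} t∈m-p = twin t , ∣twin∣ (off-ℓ t∈m-p)

  U W : KVertex (nPts q) (suc q)
  U = twin-vertex x∈m-p
  W = twin-vertex y∈m-p

  -- x ∈ U but x ∉ W, since x ∉ C and x ≠ y.
  U≢W : KDistinct U W
  U≢W same with x∈p∪q⁻ C ⁅ y ⁆ (subst (x ∈_) same (t∈twin x))
  ... | inj₁ x∈C = x∉ℓ (∈-x⇒∈ x∈C)
  ... | inj₂ x∈y = ∈-x⇒≢ (proj₂ y∈m-p-x) (sym (x∈⁅y⁆⇒x≡y y x∈y))

  lines-not-resolving : ¬ IsResolving (KAdj {nPts q} {suc q}) KDistinct (LinesAsVertices {q} Line)
  lines-not-resolving =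
    twins-not-resolving (room-for-three-lines q 2<q) (LinesAsVertices Line) U W U≢W
      (λ X X-line →
          (λ U≡X → twin-not-line (off-ℓ x∈m-p) (subst Line (sym U≡X) X-line))
        , (λ W≡X → twin-not-line (off-ℓ y∈m-p) (subst Line (sym W≡X) X-line))
        , mk⇔ (twin-transfer x∈m-p y∈m-p X-line) (twin-transfer y∈m-p x∈m-p X-line))

-- Points 0 ≠ 1 exist since q ≥ 3; the twins built from them defeat the lines.
proposition4p4 : (q : ℕ) → 2 < q → (Line : Subset (nPts q) → Set) →
    IsProjectivePlane q Line →
    ¬ IsResolving (KAdj {nPts q} {suc q}) KDistinct (LinesAsVertices {q} Line)
proposition4p4 (suc (suc (suc r))) 2<q@(s≤s (s≤s (s≤s _))) Line plane =
  Twins.lines-not-resolving plane 2<q zero (suc zero) (λ ())
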